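{- Let $G$ be a $(C_3,C_5)$-free graph. Then for every vertex $x\in V(G)$, the subgraph of $G$ induced by $N^2[x]$ is bipartite.
   Context: Graphs are finite, simple, undirected. $N^2[x]$ denotes the set of vertices at distance at most $2$ from $x$. $(C_3,C_5)$-free means containing no induced cycle of length 3 or 5. -}

module Defs where

import Data.Nat
open import Data.Nat using (ℕ; suc)
open import Data.Fin using (Fin; zero; suc; toℕ)
open import Data.Fin.Properties using ()
open import Data.Bool using (Bool)
open import Data.Product using (Σ; ∃; ∃-syntax; _×_)
open import Data.Sum using (_⊎_)
open import Relation.Nullary using (¬_; Dec; yes; no)
open import Relation.Binary.PropositionalEquality using (_≡_; _≢_)
open import Function.Definitions using (Injective)

record Graph (n : ℕ) : Set₁ where
  field
    Adj     : Fin n → Fin n → Set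
    adj?    : ∀ u v → Dec (Adj u v)
    sym     : ∀ {u v} → Adj u v → Adj v u
    irrefl  : ∀ {u} → ¬ Adj u u
open Graph public

csuc : ∀ {k} → Fin (suc k) → Fin (suc k)
csuc {k} i with toℕ i Data.Nat.<? k
... | yes p = Data.Fin.fromℕ< {suc (toℕ i)} (Data.Nat.s≤s p)
... | no _  = zero

Consecutive : ∀ {k} → Fin (suc k) → Fin (suc k) → Set
Consecutive i j = (j ≡ csuc i) ⊎ (i ≡ csuc j)

-- An induced cycle of length (suc k) in G: an injective sequence of vertices
-- c 0, …, c k where two of them are adjacent iff they are cyclically consecutive.
record InducedCycle {n : ℕ} (G : Graph n) (k : ℕ) : Set where
  field
    c         : Fin (suc k) → Fin n
    inj       : Injective _≡_ _≡_ c
    edges     : ∀ i → Adj G (c i) (c (csuc i))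
    nonEdges  : ∀ i j → i ≢ j → ¬ Consecutive i j → ¬ Adj G (c i) (c j)

HasInducedC : ∀ {n} → Graph n → ℕ → Set
HasInducedC G m = Σ ℕ λ k → (suc k ≡ m) × InducedCycle G k

C3C5Free : ∀ {n} → Graph n → Set
C3C5Free G = ¬ HasInducedC G 3 × ¬ HasInducedC G 5

InN2 : ∀ {n} → Graph n → Fin n → Fin n → Set
InN2 G x y = (y ≡ x) ⊎ Adj G x y ⊎ (∃[ z ] (Adj G x z × Adj G z y))

InducedBipartite : ∀ {n} → Graph n → (Fin n → Set) → Set
InducedBipartite {n} G S =
  Σ (Fin n → Bool) λ col →
    ∀ u v → S u → S v → Adj G u v → col u ≢ col v

-- Colour the vertices of N²[x] by adjacency to x. Two adjacent neighbours of x would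
-- span a triangle. Two adjacent vertices u, v at distance two from x, reached
-- through neighbours a and b of x, close the 5-cycle x a u v b x; each of its
-- possible chords a v, b u, a b closes a triangle, so it is an induced C₅.
module Submission where

open import Data.Nat using (ℕ; suc)
open import Data.Fin using (Fin; zero; suc)
open import Data.Fin.Properties using (_≟_; all?)
open import Data.Product using (_,_)
open import Data.Sum using (_⊎_; inj₁; inj₂)
open import Data.Unit using (tt)
open import Function using (_∘_)
open import Function.Definitions using (Injective)
open import Relation.Nullary using (¬_; Dec; yes; no; does; ¬?; contradiction)
open import Relation.Nullary.Decidable using (_⊎-dec_; _→-dec_; toWitness; decidable-stable)
open import Relation.Binary.PropositionalEquality
  using (_≡_; _≢_; refl; ≢-sym; subst)
open import Defs

private
  pattern 1F = suc zero
  pattern 2F = suc 1F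
  pattern 3F = suc 2F
  pattern 4F = suc 3F

injective-if-distinct : ∀ {m a} {A : Set a} (f : Fin m → A) →
  (∀ {i j} → i ≢ j → f i ≢ f j) → Injective _≡_ _≡_ f
injective-if-distinct f distinct {i} {j} fi≡fj =
  decidable-stable (i ≟ j) (λ i≢j → distinct i≢j fi≡fj)

consecutive? : ∀ {k} (i j : Fin (suc k)) → Dec (Consecutive i j)
consecutive? i j = (j ≟ csuc i) ⊎-dec (i ≟ csuc j)

AtDistanceTwo : ∀ {k} → Fin (suc k) → Fin (suc k) → Set
AtDistanceTwo i j = (j ≡ csuc (csuc i)) ⊎ (i ≡ csuc (csuc j))

atDistanceTwo? : ∀ {k} (i j : Fin (suc k)) → Dec (AtDistanceTwo i j)
atDistanceTwo? i j = (j ≟ csuc (csuc i)) ⊎-dec (i ≟ csuc (csuc j))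

C₃-distinct⇒consecutive : ∀ (i j : Fin 3) → i ≢ j → Consecutive i j
C₃-distinct⇒consecutive = toWitness {a? = all? λ i → all? λ j →
  ¬? (i ≟ j) →-dec consecutive? i j} tt

C₅-distinct⇒consecutive-or-atDistanceTwo : ∀ (i j : Fin 5) → i ≢ j →
  Consecutive i j ⊎ AtDistanceTwo i j
C₅-distinct⇒consecutive-or-atDistanceTwo = toWitness {a? = all? λ i → all? λ j →
  ¬? (i ≟ j) →-dec (consecutive? i j ⊎-dec atDistanceTwo? i j)} tt

module _ {n : ℕ} (G : Graph n) where

  adjacent⇒≢ : ∀ {u v} → Adj G u v → u ≢ v
  adjacent⇒≢ {u} uv refl = irrefl G uv

  separated⇒≢ : ∀ {w u v} → Adj G w u → ¬ Adj G w v → u ≢ v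
  separated⇒≢ {w} wu ¬wv u≡v = ¬wv (subst (Adj G w) u≡v wu)

  consecutive⇒≢ : ∀ {k} (c : Fin (suc k) → Fin n) →
    (∀ i → Adj G (c i) (c (csuc i))) → ∀ {i j} → Consecutive i j → c i ≢ c j
  consecutive⇒≢ c edge {i} (inj₁ refl) = adjacent⇒≢ (edge i)
  consecutive⇒≢ c edge {_} {j} (inj₂ refl) = ≢-sym (adjacent⇒≢ (edge j))

  triangle⇒C₃ : ∀ {v₀ v₁ v₂} →
    Adj G v₀ v₁ → Adj G v₁ v₂ → Adj G v₂ v₀ → HasInducedC G 3
  triangle⇒C₃ {v₀} {v₁} {v₂} e₀₁ e₁₂ e₂₀ = 2 , refl , record
    { c        = c
    ; inj      = injective-if-distinct c
                   (consecutive⇒≢ c edge ∘ C₃-distinct⇒consecutive _ _)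
    ; edges    = edge
    ; nonEdges = λ i j i≢j → contradiction (C₃-distinct⇒consecutive i j i≢j)
    }
    where
    c : Fin 3 → Fin n
    c zero = v₀
    c 1F   = v₁
    c 2F   = v₂

    edge : ∀ i → Adj G (c i) (c (csuc i))
    edge zero = e₀₁
    edge 1F   = e₁₂
    edge 2F   = e₂₀

  pentagon⇒C₅ : ∀ {v₀ v₁ v₂ v₃ v₄} →
    Adj G v₀ v₁ → Adj G v₁ v₂ → Adj G v₂ v₃ → Adj G v₃ v₄ → Adj G v₄ v₀ →
    ¬ Adj G v₀ v₂ → ¬ Adj G v₁ v₃ → ¬ Adj G v₂ v₄ → ¬ Adj G v₃ v₀ → ¬ Adj G v₄ v₁ →
    HasInducedC G 5
  pentagon⇒C₅ {v₀} {v₁} {v₂} {v₃} {v₄} e₀₁ e₁₂ e₂₃ e₃₄ e₄₀ n₀₂ n₁₃ n₂₄ n₃₀ n₄₁ =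
    4 , refl , record
    { c        = c
    ; inj      = injective-if-distinct c (distinct _ _)
    ; edges    = edge
    ; nonEdges = nonEdge
    }
    where
    c : Fin 5 → Fin n
    c zero = v₀
    c 1F   = v₁
    c 2F   = v₂
    c 3F   = v₃
    c 4F   = v₄

    edge : ∀ i → Adj G (c i) (c (csuc i))
    edge zero = e₀₁
    edge 1F   = e₁₂
    edge 2F   = e₂₃
    edge 3F   = e₃₄
    edge 4F   = e₄₀

    chordless : ∀ i → ¬ Adj G (c i) (c (csuc (csuc i)))
    chordless zero = n₀₂
    chordless 1F   = n₁₃
    chordless 2F   = n₂₄
    chordless 3F   = n₃₀
    chordless 4F   = n₄₁

    -- c i and c (i + 2) are told apart by c (i - 1), a neighbour of the first only.
    separated : ∀ i → c i ≢ c (csuc (csuc i))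
    separated zero = separated⇒≢ e₄₀ (n₂₄ ∘ sym G)
    separated 1F   = separated⇒≢ e₀₁ (n₃₀ ∘ sym G)
    separated 2F   = separated⇒≢ e₁₂ (n₄₁ ∘ sym G)
    separated 3F   = separated⇒≢ e₂₃ (n₀₂ ∘ sym G)
    separated 4F   = separated⇒≢ e₃₄ (n₁₃ ∘ sym G)

    distinct : ∀ i j → i ≢ j → c i ≢ c j
    distinct i j i≢j with C₅-distinct⇒consecutive-or-atDistanceTwo i j i≢j
    ... | inj₁ cons        = consecutive⇒≢ c edge cons
    ... | inj₂ (inj₁ refl) = separated i
    ... | inj₂ (inj₂ refl) = ≢-sym (separated j)

    nonEdge : ∀ i j → i ≢ j → ¬ Consecutive i j → ¬ Adj G (c i) (c j)
    nonEdge i j i≢j ¬cons with C₅-distinct⇒consecutive-or-atDistanceTwo i j i≢j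
    ... | inj₁ cons        = contradiction cons ¬cons
    ... | inj₂ (inj₁ refl) = chordless i
    ... | inj₂ (inj₂ refl) = chordless j ∘ sym G

  neighbours-nonadjacent : ¬ HasInducedC G 3 →
    ∀ {x u v} → Adj G x u → Adj G x v → ¬ Adj G u v
  neighbours-nonadjacent C₃-free xu xv uv = C₃-free (triangle⇒C₃ xu uv (sym G xv))

  second-neighbours-nonadjacent : ¬ HasInducedC G 3 → ¬ HasInducedC G 5 →
    ∀ {x a u b v} → Adj G x a → Adj G a u → ¬ Adj G x u →
    Adj G x b → Adj G b v → ¬ Adj G x v → ¬ Adj G u v
  second-neighbours-nonadjacent C₃-free C₅-free {_} {a} {u} {b} {v}
    xa au ¬xu xb bv ¬xv uv with adj? G a v | adj? G b u | adj? G a b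
  ... | yes av | _      | _      = neighbours-nonadjacent C₃-free au av uv
  ... | no  _  | yes bu | _      = neighbours-nonadjacent C₃-free bu bv uv
  ... | no  _  | no  _  | yes ab = neighbours-nonadjacent C₃-free xa xb ab
  ... | no ¬av | no ¬bu | no ¬ab = C₅-free
    (pentagon⇒C₅ xa au uv (sym G bv) (sym G xb) ¬xu ¬av (¬bu ∘ sym G) (¬xv ∘ sym G) (¬ab ∘ sym G))

  nonneighbours-in-N²-nonadjacent : ¬ HasInducedC G 3 → ¬ HasInducedC G 5 →
    ∀ {x u v} → InN2 G x u → InN2 G x v → ¬ Adj G x u → ¬ Adj G x v → ¬ Adj G u v
  nonneighbours-in-N²-nonadjacent _ _ (inj₁ refl) _ _ ¬xv uv = ¬xv uv
  nonneighbours-in-N²-nonadjacent _ _ (inj₂ (inj₁ xu)) _ ¬xu _ _ = ¬xu xu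
  nonneighbours-in-N²-nonadjacent _ _ _ (inj₁ refl) ¬xu _ uv = ¬xu (sym G uv)
  nonneighbours-in-N²-nonadjacent _ _ _ (inj₂ (inj₁ xv)) _ ¬xv _ = ¬xv xv
  nonneighbours-in-N²-nonadjacent C₃-free C₅-free
    (inj₂ (inj₂ (a , xa , au))) (inj₂ (inj₂ (b , xb , bv))) ¬xu ¬xv =
    second-neighbours-nonadjacent C₃-free C₅-free xa au ¬xu xb bv ¬xv

lemma16 : ∀ {n : ℕ} (G : Graph n) → C3C5Free G →
    ∀ (x : Fin n) → InducedBipartite G (InN2 G x)
lemma16 G (C₃-free , C₅-free) x = (λ y → does (adj? G x y)) , proper
  where
  proper : ∀ u v → InN2 G x u → InN2 G x v → Adj G u v →
    does (adj? G x u) ≢ does (adj? G x v)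
  proper u v u∈N² v∈N² uv with adj? G x u | adj? G x v
  ... | yes xu  | yes xv  = λ _ → neighbours-nonadjacent G C₃-free xu xv uv
  ... | no  ¬xu | no  ¬xv = λ _ →
    nonneighbours-in-N²-nonadjacent G C₃-free C₅-free u∈N² v∈N² ¬xu ¬xv uv
  ... | yes _   | no  _   = λ ()
  ... | no  _   | yes _   = λ ()
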